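{- If $\Phi_f=(C_n,F^\times,\varphi,f)$ is a skew gain cycle, then \[ \det L_g(\Phi_f)=2\sqrt{\prod_{\overrightarrow{e}\in E(C_n)}g(\varphi(\overrightarrow{e}))}-\big[\varphi(C_n)+f(\varphi(C_n))\big]. \]
   Context: $F$ is a field of characteristic zero with algebraic closure $\overline F$; $f:F^\times\to F^\times$ is an involutive automorphism and $g(x)=xf(x)$ (so $g(\varphi(\overrightarrow{e}))$ does not depend on the orientation of $e$). A skew gain graph $\Phi_f=(G,F^\times,\varphi,f)$ on an edge-oriented simple graph $G$ assigns gains $\varphi(\overrightarrow{uv})\in F^\times$ with $\varphi(\overrightarrow{vu})=f(\varphi(\overrightarrow{uv}))$; a skew gain cycle is one whose underlying graph is a cycle $C_n=v_1v_2\cdots v_nv_1$. $A(\Phi_f)=(a_{ij})$ with $a_{ij}=\varphi(\overrightarrow{v_iv_j})$ if $v_i\sim v_j$, else $0$. For each edge $e$ fix a square root $\sqrt{g(\varphi(\overrightarrow{e}))}\in\overline F$; $D_g(\Phi_f)=\mathrm{diag}\big(\sum_{e\ni v_i}\sqrt{g(\varphi(\overrightarrow{e}))}\big)$ and $L_g(\Phi_f)=D_g(\Phi_f)-A(\Phi_f)$. The expression $\sqrt{\prod_{e\in E(C_n)}g(\varphi(\overrightarrow{e}))}$ means $\prod_{e\in E(C_n)}\sqrt{g(\varphi(\overrightarrow{e}))}$ with the fixed square roots. $\varphi(C_n)=\varphi(\overrightarrow{v_1v_2})\varphi(\overrightarrow{v_2v_3})\cdots\varphi(\overrightarrow{v_nv_1})$.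 -}

module Defs where

open import Level using (Level; _⊔_)
open import Data.Nat using (ℕ; zero; suc; _≡ᵇ_)
open import Data.Fin using (Fin; zero; suc; punchIn; _≟_)
open import Data.List using (List; []; _∷_; foldr; map; _∷ʳ_)
open import Data.Product using (Σ; ∃; _×_; _,_)
open import Relation.Nullary using (¬_; Dec; yes; no)
open import Relation.Nullary.Decidable using (⌊_⌋)
open import Data.Bool using (Bool; true; false; if_then_else_; _∨_)
open import Relation.Binary.PropositionalEquality using (_≡_)
open import Algebra.Bundles using (CommutativeRing)
open import Algebra.Morphism.Structures using (IsRingHomomorphism)

module RingDefs {c ℓ : Level} (R : CommutativeRing c ℓ) where
  open CommutativeRing R using (Carrier; _≈_; _+_; _*_; -_; 0#; 1#)

  sumFin : ∀ {n} → (Fin n → Carrier) → Carrier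
  sumFin {zero}  h = 0#
  sumFin {suc n} h = h zero + sumFin (λ i → h (suc i))

  prodFin : ∀ {n} → (Fin n → Carrier) → Carrier
  prodFin {zero}  h = 1#
  prodFin {suc n} h = h zero * prodFin (λ i → h (suc i))

  sgn : ∀ {n} → Fin n → Carrier
  sgn zero    = 1#
  sgn (suc j) = - sgn j

  det : ∀ n → (Fin n → Fin n → Carrier) → Carrier
  det zero    M = 1#
  det (suc n) M =
    sumFin (λ j → sgn j * (M zero j * det n (λ r k → M (suc r) (punchIn j k))))

  ofℕ : ℕ → Carrier
  ofℕ zero    = 0#
  ofℕ (suc m) = 1# + ofℕ m

  IsField : Set (c ⊔ ℓ)
  IsField = (¬ (1# ≈ 0#)) × (∀ x → ¬ (x ≈ 0#) → ∃ λ y → x * y ≈ 1#)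

  CharZero : Set ℓ
  CharZero = ∀ m → ¬ (ofℕ (suc m) ≈ 0#)

  -- evaluation of the polynomial a₀ + a₁ X + … given by its coefficient list
  evalPoly : List Carrier → Carrier → Carrier
  evalPoly cs x = foldr (λ a acc → a + x * acc) 0# cs

  -- every monic polynomial of degree ≥ 1 has a root
  IsAlgClosed : Set (c ⊔ ℓ)
  IsAlgClosed = ∀ (a : Carrier) (cs : List Carrier) →
    ∃ λ x → evalPoly ((a ∷ cs) ∷ʳ 1#) x ≈ 0#

record IsAlgebraicClosure {c ℓ c' ℓ' : Level}
    (F : CommutativeRing c ℓ) (K : CommutativeRing c' ℓ')
    (ι : CommutativeRing.Carrier F → CommutativeRing.Carrier K)
    : Set (c ⊔ ℓ ⊔ c' ⊔ ℓ') where
  field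
    ι-hom       : IsRingHomomorphism (CommutativeRing.rawRing F)
                    (CommutativeRing.rawRing K) ι
    K-field     : RingDefs.IsField K
    K-algClosed : RingDefs.IsAlgClosed K
    K-algebraic : ∀ (x : CommutativeRing.Carrier K) →
      ∃ λ (ps : List (CommutativeRing.Carrier F)) →
        CommutativeRing._≈_ K
          (RingDefs.evalPoly K (map ι ps ∷ʳ CommutativeRing.1# K) x)
          (CommutativeRing.0# K)

-- Cyclic successor on Fin (suc k): i ↦ i+1 mod (suc k)
next : ∀ {k} → Fin (suc k) → Fin (suc k)
next {zero}  zero    = zero
next {suc k} zero    = suc zero
next {suc k} (suc i) with next {k} i
... | zero  = zero
... | suc j = suc (suc j)

-- Involutive automorphism of the multiplicative group F^× (elements of F
-- that are ≉ 0); f is given as a function on F, only its values on F^× matter.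
record IsInvolutiveAutF× {c ℓ : Level} (F : CommutativeRing c ℓ)
    (f : CommutativeRing.Carrier F → CommutativeRing.Carrier F) : Set (c ⊔ ℓ) where
  open CommutativeRing F using (Carrier; _≈_; _*_; 0#)
  field
    f-nonzero : ∀ x → ¬ (x ≈ 0#) → ¬ (f x ≈ 0#)
    f-cong    : ∀ x y → ¬ (x ≈ 0#) → x ≈ y → f x ≈ f y
    f-hom     : ∀ x y → ¬ (x ≈ 0#) → ¬ (y ≈ 0#) → f (x * y) ≈ f x * f y
    f-invol   : ∀ x → ¬ (x ≈ 0#) → f (f x) ≈ x

-- The skew gain cycle on C_n, vertices v_i = i ∈ Fin n, edges e_i = v_i v_{i+1}
-- (indices mod n).  The gain of the oriented edge v_i → v_{i+1} is w i ∈ F^×,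
-- and that of v_{i+1} → v_i is f (w i).  Matrices are taken in K (⊇ F via ι),
-- with s i a fixed square root of g(φ(e_i)) = w i · f (w i).
module SkewGainCycle {c ℓ c' ℓ' : Level}
    (F : CommutativeRing c ℓ) (K : CommutativeRing c' ℓ')
    (ι : CommutativeRing.Carrier F → CommutativeRing.Carrier K)
    (f : CommutativeRing.Carrier F → CommutativeRing.Carrier F)
    (m : ℕ)
    (w : Fin (suc (suc (suc m))) → CommutativeRing.Carrier F)
    (s : Fin (suc (suc (suc m))) → CommutativeRing.Carrier K) where

  n : ℕ
  n = suc (suc (suc m))

  open CommutativeRing K using (Carrier; _≈_; _+_; _*_; -_; _-_; 0#; 1#)

  adj : Fin n → Fin n → Carrier
  adj i j =
    if ⌊ j ≟ next i ⌋ then ι (w i)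
    else if ⌊ i ≟ next j ⌋ then ι (f (w j))
    else 0#

  degG : Fin n → Carrier
  degG i = RingDefs.sumFin K
    (λ j → if ⌊ i ≟ j ⌋ ∨ ⌊ i ≟ next j ⌋ then s j else 0#)

  Lg : Fin n → Fin n → Carrier
  Lg i j = (if ⌊ i ≟ j ⌋ then degG i else 0#) - adj i j

  φC : CommutativeRing.Carrier F
  φC = RingDefs.prodFin F w

module Submission where

-- Indexed by ℕ, L_g is a cyclic tridiagonal matrix C: diagonal s_i + s_{i−1}, superdiagonal
-- −φ(e_i), subdiagonal −f(φ(e_i)), closed up by the two corner entries. Expanding det C along
-- its first row, and the two off-diagonal minors along their first column, gives
--   det C = c₀₀ T₁ − c₀₁ c₁₀ T₂ − c_{L0} c_{0L} T₃ − (∏ (−superdiagonal) + ∏ (−subdiagonal)),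
-- where T₁, T₂, T₃ are continuants of tridiagonal blocks. Since φ(e_i) f(φ(e_i)) = s_i², these
-- are continuants with diagonal x_i + x_{i+1} and off-diagonal products x_{i+1}², i.e. elementary
-- symmetric polynomials of degree k in x_0, …, x_k; the first three terms then collapse to
-- 2 ∏ s_i, while the last is ι(φ(C_n)) + ι(f(φ(C_n))).

open import Level using (Level)
open import Data.Nat as ℕ using (ℕ; zero; suc; s≤s; z≤n)
open import Data.Fin as Fin using (Fin; zero; suc; punchIn; toℕ; fromℕ; fromℕ<; inject₁)
open import Data.Maybe using (Maybe; just; nothing)
open import Data.Product using (_×_; _,_; proj₁; proj₂)
open import Data.Sum using (_⊎_; inj₁; inj₂)
open import Data.Bool using (Bool; true; false; if_then_else_; T; _∨_)
open import Data.Empty using (⊥-elim)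
open import Relation.Binary.PropositionalEquality as ≡ using (_≡_; _≢_)
open import Function using (_∘_)
import Data.Fin.Properties as Finₚ
open import Relation.Nullary using (¬_; Dec; yes; no)
open import Relation.Nullary.Decidable using (⌊_⌋)
open import Relation.Binary.Definitions using (DecidableEquality)
open import Algebra.Bundles using (CommutativeRing; RawRing)
open import Algebra.Morphism.Structures using (IsRingHomomorphism)
open import Algebra.Solver.Ring.AlmostCommutativeRing
  using (fromCommutativeRing; _-Raw-AlmostCommutative⟶_)
import Algebra.Solver.Ring
import Data.Nat.Properties as ℕₚ

open import Defs

-- The ring solver for an arbitrary commutative ring, with the integers as
-- coefficients; an integer is represented by a pair (a , b) standing for a − b.
module IntegerCoefficientSolver {c ℓ} (K : CommutativeRing c ℓ) where
  open CommutativeRing K hiding (zero)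
  open import Algebra.Properties.Ring ring
    using (-‿distribˡ-*; -‿+-comm; -0#≈0#; ⁻¹-anti-homo‿-; x[y-z]≈xy-xz)
  open import Algebra.Properties.CommutativeSemigroup +-commutativeSemigroup
    using (interchange)
  open import Algebra.Properties.Semiring.Mult.TCOptimised semiring
    using (×-homo-+; ×1-homo-*)
    renaming (_×_ to _×ₙ_)
  open import Relation.Binary.Reasoning.Setoid setoid

  ℤ-pairs : RawRing _ _
  ℤ-pairs = record
    { Carrier = ℕ × ℕ
    ; _≈_     = _≡_
    ; _+_     = λ (a , b) (c , d) → (a ℕ.+ c , b ℕ.+ d)
    ; _*_     = λ (a , b) (c , d) → (a ℕ.* c ℕ.+ b ℕ.* d , a ℕ.* d ℕ.+ b ℕ.* c)
    ; -_      = λ (a , b) → (b , a)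
    ; 0#      = (0 , 0)
    ; 1#      = (1 , 0)
    }

  ⌜_⌝ : ℕ → Carrier
  ⌜ a ⌝ = a ×ₙ 1#

  -- The clause split makes the constants 0 and 1 evaluate to 0# and 1# definitionally.
  ⟦_⟧ : ℕ × ℕ → Carrier
  ⟦ (a , zero)  ⟧ = ⌜ a ⌝
  ⟦ (a , suc b) ⟧ = ⌜ a ⌝ - ⌜ suc b ⌝

  ⟦⟧≈difference : ∀ a b → ⟦ (a , b) ⟧ ≈ ⌜ a ⌝ - ⌜ b ⌝
  ⟦⟧≈difference a zero    = sym (trans (+-congˡ -0#≈0#) (+-identityʳ _))
  ⟦⟧≈difference a (suc b) = refl

  ⌜⌝-+ : ∀ a b → ⌜ a ℕ.+ b ⌝ ≈ ⌜ a ⌝ + ⌜ b ⌝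
  ⌜⌝-+ = ×-homo-+ 1#

  ⌜⌝-*+* : ∀ a b c d → ⌜ a ℕ.* b ℕ.+ c ℕ.* d ⌝ ≈ ⌜ a ⌝ * ⌜ b ⌝ + ⌜ c ⌝ * ⌜ d ⌝
  ⌜⌝-*+* a b c d = trans (⌜⌝-+ (a ℕ.* b) (c ℕ.* d)) (+-cong (×1-homo-* a b) (×1-homo-* c d))

  +-sub : ∀ x y u v → (x + u) - (y + v) ≈ (x - y) + (u - v)
  +-sub x y u v = trans (+-congˡ (sym (-‿+-comm y v))) (interchange x u (- y) (- v))

  sub-*-sub : ∀ x y u v → (x - y) * (u - v) ≈ (x * u + y * v) - (x * v + y * u)
  sub-*-sub x y u v = begin
    (x - y) * (u - v)                  ≈⟨ distribʳ (u - v) x (- y) ⟩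
    x * (u - v) + - y * (u - v)        ≈⟨ +-congˡ (sym (-‿distribˡ-* y (u - v))) ⟩
    x * (u - v) - y * (u - v)          ≈⟨ +-cong (x[y-z]≈xy-xz x u v) (-‿cong (x[y-z]≈xy-xz y u v)) ⟩
    (x * u - x * v) - (y * u - y * v)  ≈⟨ +-congˡ (⁻¹-anti-homo‿- (y * u) (y * v)) ⟩
    (x * u - x * v) + (y * v - y * u)  ≈⟨ sym (+-sub (x * u) (x * v) (y * v) (y * u)) ⟩
    (x * u + y * v) - (x * v + y * u)  ∎

  sub-cong : ∀ x y u v → x + v ≈ u + y → x - y ≈ u - v
  sub-cong x y u v eq = begin
    x - y              ≈⟨ sym (+-identityʳ (x - y)) ⟩
    (x - y) + 0#       ≈⟨ +-congˡ (sym (-‿inverseʳ v)) ⟩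
    (x - y) + (v - v)  ≈⟨ sym (+-sub x y v v) ⟩
    (x + v) - (y + v)  ≈⟨ +-cong eq (-‿cong (+-comm y v)) ⟩
    (u + y) - (v + y)  ≈⟨ +-sub u v y y ⟩
    (u - v) + (y - y)  ≈⟨ +-congˡ (-‿inverseʳ y) ⟩
    (u - v) + 0#       ≈⟨ +-identityʳ (u - v) ⟩
    u - v              ∎

  ⟦⟧-morphism : ℤ-pairs -Raw-AlmostCommutative⟶ fromCommutativeRing K
  ⟦⟧-morphism = record
    { ⟦_⟧    = ⟦_⟧
    ; +-homo = λ (a , b) (c , d) → begin
        ⟦ (a ℕ.+ c , b ℕ.+ d) ⟧              ≈⟨ ⟦⟧≈difference (a ℕ.+ c) (b ℕ.+ d) ⟩
        ⌜ a ℕ.+ c ⌝ - ⌜ b ℕ.+ d ⌝            ≈⟨ +-cong (⌜⌝-+ a c) (-‿cong (⌜⌝-+ b d)) ⟩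
        (⌜ a ⌝ + ⌜ c ⌝) - (⌜ b ⌝ + ⌜ d ⌝)    ≈⟨ +-sub _ _ _ _ ⟩
        (⌜ a ⌝ - ⌜ b ⌝) + (⌜ c ⌝ - ⌜ d ⌝)    ≈⟨ sym (+-cong (⟦⟧≈difference a b) (⟦⟧≈difference c d)) ⟩
        ⟦ (a , b) ⟧ + ⟦ (c , d) ⟧            ∎
    ; *-homo = λ (a , b) (c , d) → begin
        ⟦ (a ℕ.* c ℕ.+ b ℕ.* d , a ℕ.* d ℕ.+ b ℕ.* c) ⟧
          ≈⟨ ⟦⟧≈difference (a ℕ.* c ℕ.+ b ℕ.* d) (a ℕ.* d ℕ.+ b ℕ.* c) ⟩
        ⌜ a ℕ.* c ℕ.+ b ℕ.* d ⌝ - ⌜ a ℕ.* d ℕ.+ b ℕ.* c ⌝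
          ≈⟨ +-cong (⌜⌝-*+* a c b d) (-‿cong (⌜⌝-*+* a d b c)) ⟩
        (⌜ a ⌝ * ⌜ c ⌝ + ⌜ b ⌝ * ⌜ d ⌝) - (⌜ a ⌝ * ⌜ d ⌝ + ⌜ b ⌝ * ⌜ c ⌝)
          ≈⟨ sym (sub-*-sub _ _ _ _) ⟩
        (⌜ a ⌝ - ⌜ b ⌝) * (⌜ c ⌝ - ⌜ d ⌝)
          ≈⟨ sym (*-cong (⟦⟧≈difference a b) (⟦⟧≈difference c d)) ⟩
        ⟦ (a , b) ⟧ * ⟦ (c , d) ⟧ ∎
    ; -‿homo = λ (a , b) → begin
        ⟦ (b , a) ⟧        ≈⟨ ⟦⟧≈difference b a ⟩
        ⌜ b ⌝ - ⌜ a ⌝      ≈⟨ sym (⁻¹-anti-homo‿- _ _) ⟩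
        - (⌜ a ⌝ - ⌜ b ⌝)  ≈⟨ sym (-‿cong (⟦⟧≈difference a b)) ⟩
        - ⟦ (a , b) ⟧      ∎
    ; 0-homo = refl
    ; 1-homo = refl
    }

  _≟-coefficient_ : ∀ p q → Maybe (⟦ p ⟧ ≈ ⟦ q ⟧)
  (a , b) ≟-coefficient (c , d) with a ℕ.+ d ℕ.≟ c ℕ.+ b
  ... | no _   = nothing
  ... | yes eq = just (begin
    ⟦ (a , b) ⟧    ≈⟨ ⟦⟧≈difference a b ⟩
    ⌜ a ⌝ - ⌜ b ⌝  ≈⟨ sub-cong _ _ _ _ (trans (sym (⌜⌝-+ a d)) (trans (reflexive (≡.cong ⌜_⌝ eq)) (⌜⌝-+ c b))) ⟩
    ⌜ c ⌝ - ⌜ d ⌝  ≈⟨ sym (⟦⟧≈difference c d) ⟩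
    ⟦ (c , d) ⟧    ∎)

  open Algebra.Solver.Ring ℤ-pairs (fromCommutativeRing K) ⟦⟧-morphism _≟-coefficient_ public
    using (solve; _:+_; _:*_; :-_; _:-_; con; _:=_)

module Determinant {c ℓ} (K : CommutativeRing c ℓ) where
  open CommutativeRing K hiding (zero)
  open RingDefs K
  open import Algebra.Properties.CommutativeSemigroup +-commutativeSemigroup using (interchange)
  open IntegerCoefficientSolver K using (solve; _:+_; _:*_; :-_; _:-_; con; _:=_)
  open import Relation.Binary.Reasoning.Setoid setoid

  sumFin-cong : ∀ {n} {h h′ : Fin n → Carrier} → (∀ j → h j ≈ h′ j) → sumFin h ≈ sumFin h′
  sumFin-cong {zero}  eq = refl
  sumFin-cong {suc n} eq = +-cong (eq zero) (sumFin-cong (λ j → eq (suc j)))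

  sumFin-zero : ∀ {n} {h : Fin n → Carrier} → (∀ j → h j ≈ 0#) → sumFin h ≈ 0#
  sumFin-zero {zero}  eq = refl
  sumFin-zero {suc n} eq = trans (+-cong (eq zero) (sumFin-zero (λ j → eq (suc j)))) (+-identityʳ 0#)

  sumFin-single : ∀ {n} {h : Fin n → Carrier} (p : Fin n) → (∀ j → j ≢ p → h j ≈ 0#) → sumFin h ≈ h p
  sumFin-single zero    eq = trans (+-congˡ (sumFin-zero (λ j → eq (suc j) λ ()))) (+-identityʳ _)
  sumFin-single (suc p) eq =
    trans (+-cong (eq zero λ ()) (sumFin-single p (λ j j≢p → eq (suc j) (j≢p ∘ Finₚ.suc-injective))))
          (+-identityˡ _)

  sumFin-+ : ∀ {n} (h h′ : Fin n → Carrier) → sumFin (λ j → h j + h′ j) ≈ sumFin h + sumFin h′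
  sumFin-+ {zero}  h h′ = sym (+-identityʳ 0#)
  sumFin-+ {suc n} h h′ =
    trans (+-congˡ (sumFin-+ (λ j → h (suc j)) (λ j → h′ (suc j)))) (interchange _ _ _ _)

  *-distribˡ-sumFin : ∀ {n} x (h : Fin n → Carrier) → x * sumFin h ≈ sumFin (λ j → x * h j)
  *-distribˡ-sumFin {zero}  x h = zeroʳ x
  *-distribˡ-sumFin {suc n} x h = trans (distribˡ x _ _) (+-congˡ (*-distribˡ-sumFin x (λ j → h (suc j))))

  prodFin-cong : ∀ {n} {h h′ : Fin n → Carrier} → (∀ j → h j ≈ h′ j) → prodFin h ≈ prodFin h′
  prodFin-cong {zero}  eq = refl
  prodFin-cong {suc n} eq = *-cong (eq zero) (prodFin-cong (λ j → eq (suc j)))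

  Matrix : ℕ → Set c
  Matrix n = Fin n → Fin n → Carrier

  minor : ∀ {n} → Matrix (suc n) → Fin (suc n) → Matrix n
  minor M j r k = M (suc r) (punchIn j k)

  cofactor : ∀ {n} → Matrix (suc n) → Fin (suc n) → Carrier
  cofactor {n} M j = sgn j * (M zero j * det n (minor M j))

  cofactor-zeroˡ : ∀ σ {x} y → x ≈ 0# → σ * (x * y) ≈ 0#
  cofactor-zeroˡ σ y x≈0 = trans (*-congˡ (trans (*-congʳ x≈0) (zeroˡ y))) (zeroʳ σ)

  cofactor-zeroʳ : ∀ σ x {y} → y ≈ 0# → σ * (x * y) ≈ 0#
  cofactor-zeroʳ σ x y≈0 = trans (*-congˡ (trans (*-congˡ y≈0) (zeroʳ x))) (zeroʳ σ)

  det-cong : ∀ n {M N : Matrix n} → (∀ i j → M i j ≈ N i j) → det n M ≈ det n N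
  det-cong zero    eq = refl
  det-cong (suc n) {M} {N} eq = sumFin-cong {h = cofactor M} {cofactor N} λ j →
    *-congˡ (*-cong (eq zero j) (det-cong n (λ r k → eq (suc r) (punchIn j k))))

  det-column0-zero : ∀ n (M : Matrix (suc n)) → (∀ r → M r zero ≈ 0#) → det (suc n) M ≈ 0#
  det-column0-zero zero    M eq = trans (+-identityʳ _) (cofactor-zeroˡ 1# _ (eq zero))
  det-column0-zero (suc n) M eq =
    trans (+-cong (cofactor-zeroˡ 1# _ (eq zero)) (sumFin-zero {h = cofactor M ∘ suc} λ j →
            cofactor-zeroʳ _ _ (det-column0-zero n (minor M (suc j)) (λ r → eq (suc r)))))
          (+-identityʳ 0#)

  det-column0-top : ∀ n (M : Matrix (suc n)) → (∀ r → M (suc r) zero ≈ 0#) →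
                    det (suc n) M ≈ M zero zero * det n (minor M zero)
  det-column0-top zero    M eq = trans (+-identityʳ _) (*-identityˡ _)
  det-column0-top (suc n) M eq =
    trans (+-congˡ (sumFin-zero {h = cofactor M ∘ suc} λ j →
            cofactor-zeroʳ _ _ (det-column0-zero n (minor M (suc j)) eq)))
          (trans (+-identityʳ _) (*-identityˡ _))

  det-column0-bottom : ∀ p (M : Matrix (suc p)) → (∀ (r : Fin p) → M (inject₁ r) zero ≈ 0#) →
    det (suc p) M ≈ sgn (fromℕ p) * (M (fromℕ p) zero * det p (λ r k → M (inject₁ r) (suc k)))
  det-column0-corners : ∀ p (M : Matrix (suc (suc p))) → (∀ (r : Fin p) → M (suc (inject₁ r)) zero ≈ 0#) →
    det (suc (suc p)) M ≈ M zero zero * det (suc p) (minor M zero)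
      + sgn (fromℕ (suc p)) * (M (fromℕ (suc p)) zero * det (suc p) (λ r k → M (inject₁ r) (suc k)))

  det-column0-bottom zero    M eq = +-identityʳ _
  det-column0-bottom (suc p) M eq =
    trans (det-column0-corners p M (eq ∘ suc))
          (trans (+-congʳ (trans (*-congʳ (eq zero)) (zeroˡ _))) (+-identityˡ _))

  det-column0-corners p M eq = +-cong (*-identityˡ _) (begin
    sumFin (cofactor M ∘ suc)
      ≈⟨ sumFin-cong {h = cofactor M ∘ suc} {λ j → (- σ) * (q * cofactor N j)} (λ j →
           trans (*-congˡ (*-congˡ (det-column0-bottom p (minor M (suc j)) eq)))
                 (reorder (sgn j) (M zero (suc j)) σ q (det p (minor N j)))) ⟩
    sumFin (λ j → (- σ) * (q * cofactor N j))
      ≈⟨ sym (*-distribˡ-sumFin (- σ) (λ j → q * cofactor N j)) ⟩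
    (- σ) * sumFin (λ j → q * cofactor N j)
      ≈⟨ *-congˡ (sym (*-distribˡ-sumFin q (cofactor N))) ⟩
    (- σ) * (q * det (suc p) N) ∎)
    where
    σ q : Carrier
    σ = sgn (fromℕ p)
    q = M (fromℕ (suc p)) zero
    N : Matrix (suc p)
    N r k = M (inject₁ r) (suc k)
    reorder : ∀ s m σ q d → (- s) * (m * (σ * (q * d))) ≈ (- σ) * (q * (s * (m * d)))
    reorder = solve 5 (λ s m σ q d → (:- s) :* (m :* (σ :* (q :* d))) := (:- σ) :* (q :* (s :* (m :* d)))) refl

  det-lowerTriangular : ∀ n (M : Matrix n) → (∀ r k → r Fin.< k → M r k ≈ 0#) → det n M ≈ prodFin (λ i → M i i)
  det-lowerTriangular zero    M eq = refl
  det-lowerTriangular (suc n) M eq =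
    trans (+-congˡ (sumFin-zero {h = cofactor M ∘ suc} λ j → cofactor-zeroˡ _ _ (eq zero (suc j) (s≤s z≤n))))
          (trans (+-identityʳ _) (trans (*-identityˡ _) (*-congˡ
            (det-lowerTriangular n (minor M zero) (λ r k r<k → eq (suc r) (suc k) (s≤s r<k))))))

  det-upperTriangular : ∀ n (M : Matrix n) → (∀ r k → k Fin.< r → M r k ≈ 0#) → det n M ≈ prodFin (λ i → M i i)
  det-upperTriangular zero    M eq = refl
  det-upperTriangular (suc n) M eq =
    trans (det-column0-top n M (λ r → eq (suc r) zero (s≤s z≤n)))
          (*-congˡ (det-upperTriangular n (minor M zero) (λ r k k<r → eq (suc r) (suc k) (s≤s k<r))))

  continuant : (ℕ → Carrier) → (ℕ → Carrier) → ℕ → Carrier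
  continuant a p zero          = 1#
  continuant a p (suc zero)    = a 0
  continuant a p (suc (suc k)) =
    a 0 * continuant (λ i → a (suc i)) (λ i → p (suc i)) (suc k)
      - p 0 * continuant (λ i → a (2 ℕ.+ i)) (λ i → p (2 ℕ.+ i)) k

  continuant-cong : ∀ k {a a′ p p′ : ℕ → Carrier} →
    (∀ i → i ℕ.< k → a i ≈ a′ i) → (∀ i → suc i ℕ.< k → p i ≈ p′ i) → continuant a p k ≈ continuant a′ p′ k
  continuant-cong zero          ea ep = refl
  continuant-cong (suc zero)    ea ep = ea 0 (s≤s z≤n)
  continuant-cong (suc (suc k)) ea ep =
    +-cong (*-cong (ea 0 (s≤s z≤n))
                   (continuant-cong (suc k) (λ i i<k → ea (suc i) (s≤s i<k)) (λ i i<k → ep (suc i) (s≤s i<k))))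
           (-‿cong (*-cong (ep 0 (s≤s (s≤s z≤n)))
                           (continuant-cong k (λ i i<k → ea (2 ℕ.+ i) (s≤s (s≤s i<k)))
                                              (λ i i<k → ep (2 ℕ.+ i) (s≤s (s≤s i<k))))))


  bandContinuant : (ℕ → ℕ → Carrier) → ℕ → Carrier
  bandContinuant B = continuant (λ i → B i i) (λ i → B i (suc i) * B (suc i) i)

  Tridiagonal : ℕ → (ℕ → ℕ → Carrier) → Set ℓ
  Tridiagonal k B = ∀ a b → b ℕ.< k → 2 ℕ.+ a ℕ.≤ b → B a b ≈ 0# × B b a ≈ 0#

  shift : (ℕ → ℕ → Carrier) → ℕ → ℕ → Carrier
  shift B a b = B (suc a) (suc b)

  Tridiagonal-shift : ∀ {k B} → Tridiagonal (suc k) B → Tridiagonal k (shift B)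
  Tridiagonal-shift tri a b b<k a+2≤b = tri (suc a) (suc b) (s≤s b<k) (s≤s a+2≤b)

  det-tridiagonal : ∀ k (B : ℕ → ℕ → Carrier) → Tridiagonal k B →
    det k (λ r c → B (toℕ r) (toℕ c)) ≈ bandContinuant B k
  det-tridiagonal zero          B tri = refl
  det-tridiagonal (suc zero)    B tri = trans (+-identityʳ _) (trans (*-identityˡ _) (*-identityʳ _))
  det-tridiagonal (suc (suc k)) B tri = begin
    1# * (B 0 0 * det (suc k) (minor M zero))
      + ((- 1#) * (B 0 1 * det (suc k) minor₁) + sumFin (λ j → cofactor M (suc (suc j))))
      ≈⟨ +-cong (*-congˡ (*-congˡ (det-tridiagonal (suc k) (shift B) (Tridiagonal-shift tri))))
                (+-cong (*-congˡ (*-congˡ (trans (det-column0-top k minor₁ below-10) (*-congˡ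
                           (det-tridiagonal k (shift (shift B)) (Tridiagonal-shift (Tridiagonal-shift tri)))))))
                        (sumFin-zero {h = λ j → cofactor M (suc (suc j))} λ j →
                           cofactor-zeroˡ _ _ (proj₁ (tri 0 (2 ℕ.+ toℕ j) (s≤s (s≤s (Finₚ.toℕ<n j)))
                                                           (s≤s (s≤s z≤n)))))) ⟩
    1# * (B 0 0 * T₁) + ((- 1#) * (B 0 1 * (B 1 0 * T₂)) + 0#)
      ≈⟨ expand (B 0 0) T₁ (B 0 1) (B 1 0) T₂ ⟩
    B 0 0 * T₁ - B 0 1 * B 1 0 * T₂ ∎
    where
    M : Matrix (suc (suc k))
    M r c = B (toℕ r) (toℕ c)
    minor₁ : Matrix (suc k)
    minor₁ = minor M (suc zero)
    below-10 : ∀ r → minor₁ (suc r) zero ≈ 0#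
    below-10 r = proj₂ (tri 0 (2 ℕ.+ toℕ r) (s≤s (s≤s (Finₚ.toℕ<n r))) (s≤s (s≤s z≤n)))
    T₁ T₂ : Carrier
    T₁ = bandContinuant (shift B) (suc k)
    T₂ = bandContinuant (shift (shift B)) k
    expand : ∀ b₀₀ t₁ b₀₁ b₁₀ t₂ → 1# * (b₀₀ * t₁) + ((- 1#) * (b₀₁ * (b₁₀ * t₂)) + 0#) ≈ b₀₀ * t₁ - b₀₁ * b₁₀ * t₂
    expand = solve 5 (λ b₀₀ t₁ b₀₁ b₁₀ t₂ →
      con (1 , 0) :* (b₀₀ :* t₁) :+ ((:- con (1 , 0)) :* (b₀₁ :* (b₁₀ :* t₂)) :+ con (0 , 0))
        := b₀₀ :* t₁ :- b₀₁ :* b₁₀ :* t₂) refl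

module Products {c ℓ} (K : CommutativeRing c ℓ) where
  open CommutativeRing K hiding (zero)
  open RingDefs K
  open IntegerCoefficientSolver K using (solve; _:*_; :-_; _:=_)

  prodℕ : (ℕ → Carrier) → ℕ → Carrier
  prodℕ x zero    = 1#
  prodℕ x (suc k) = x 0 * prodℕ (λ i → x (suc i)) k

  prodFin-toℕ : ∀ k (x : ℕ → Carrier) → prodFin {k} (λ i → x (toℕ i)) ≈ prodℕ x k
  prodFin-toℕ zero    x = refl
  prodFin-toℕ (suc k) x = *-congˡ (prodFin-toℕ k (λ i → x (suc i)))

  prodℕ-cong : ∀ k {x y : ℕ → Carrier} → (∀ i → i ℕ.< k → x i ≈ y i) → prodℕ x k ≈ prodℕ y k
  prodℕ-cong zero    eq = refl
  prodℕ-cong (suc k) eq = *-cong (eq 0 (s≤s z≤n)) (prodℕ-cong k (λ i i<k → eq (suc i) (s≤s i<k)))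

  prodℕ-snoc : ∀ k (x : ℕ → Carrier) → prodℕ x (suc k) ≈ prodℕ x k * x k
  prodℕ-snoc zero    x = trans (*-identityʳ _) (sym (*-identityˡ _))
  prodℕ-snoc (suc k) x = trans (*-congˡ (prodℕ-snoc k (λ i → x (suc i)))) (sym (*-assoc _ _ _))

  prodℕ-neg : ∀ k (x : ℕ → Carrier) → prodℕ (λ i → - x i) k ≈ sgn (fromℕ k) * prodℕ x k
  prodℕ-neg zero    x = sym (*-identityˡ 1#)
  prodℕ-neg (suc k) x = trans (*-congˡ (prodℕ-neg k (λ i → x (suc i))))
    (solve 3 (λ a s p → (:- a) :* (s :* p) := (:- s) :* (a :* p)) refl
             (x 0) (sgn (fromℕ k)) (prodℕ (λ i → x (suc i)) k))

  sgn-square : ∀ {n} (j : Fin n) → sgn j * sgn j ≈ 1#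
  sgn-square zero    = *-identityˡ 1#
  sgn-square (suc j) = trans (solve 1 (λ s → (:- s) :* (:- s) := s :* s) refl (sgn j)) (sgn-square j)

module PathContinuant {c ℓ} (K : CommutativeRing c ℓ) where
  open CommutativeRing K hiding (zero)
  open Determinant K using (continuant)
  open Products K using (prodℕ; prodℕ-snoc)
  open IntegerCoefficientSolver K using (solve; _:+_; _:*_; _:-_; con; _:=_)

  pathContinuant : (ℕ → Carrier) → ℕ → Carrier
  pathContinuant x = continuant (λ i → x i + x (suc i)) (λ i → x (suc i) * x (suc i))

  pathContinuant-peelˡ : ∀ k (x : ℕ → Carrier) →
    pathContinuant x (suc k) ≈ prodℕ (λ i → x (suc i)) (suc k) + x 0 * pathContinuant (λ i → x (suc i)) k
  pathContinuant-peelˡ zero    x =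
    solve 2 (λ x₀ x₁ → x₀ :+ x₁ := x₁ :* con (1 , 0) :+ x₀ :* con (1 , 0)) refl (x 0) (x 1)
  pathContinuant-peelˡ (suc k) x =
    trans (+-congʳ (*-congˡ peel))
          (trans (regroup (x 0) (x 1) (prodℕ (λ i → x (2 ℕ.+ i)) (suc k)) (pathContinuant (λ i → x (2 ℕ.+ i)) k))
                 (+-congˡ (*-congˡ (sym peel))))
    where
    peel = pathContinuant-peelˡ k (λ i → x (suc i))
    regroup : ∀ x₀ x₁ p e → (x₀ + x₁) * (p + x₁ * e) - x₁ * x₁ * e ≈ x₁ * p + x₀ * (p + x₁ * e)
    regroup = solve 4 (λ x₀ x₁ p e →
      (x₀ :+ x₁) :* (p :+ x₁ :* e) :- x₁ :* x₁ :* e := x₁ :* p :+ x₀ :* (p :+ x₁ :* e)) refl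

  pathContinuant-peelʳ : ∀ k (x : ℕ → Carrier) →
    pathContinuant x (suc k) ≈ prodℕ x (suc k) + x (suc k) * pathContinuant x k
  pathContinuant-peelʳ zero          x =
    solve 2 (λ x₀ x₁ → x₀ :+ x₁ := x₀ :* con (1 , 0) :+ x₁ :* con (1 , 0)) refl (x 0) (x 1)
  pathContinuant-peelʳ (suc zero)    x =
    solve 3 (λ x₀ x₁ x₂ → (x₀ :+ x₁) :* (x₁ :+ x₂) :- x₁ :* x₁ :* con (1 , 0)
                          := x₀ :* (x₁ :* con (1 , 0)) :+ x₂ :* (x₀ :+ x₁)) refl (x 0) (x 1) (x 2)
  pathContinuant-peelʳ (suc (suc k)) x =
    trans (+-cong (*-congˡ (pathContinuant-peelʳ (suc k) (λ i → x (suc i))))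
                  (-‿cong (*-congˡ (pathContinuant-peelʳ k (λ i → x (2 ℕ.+ i))))))
          (regroup (x 0) (x 1) (x (3 ℕ.+ k)) (prodℕ (λ i → x (2 ℕ.+ i)) (suc k))
                   (pathContinuant (λ i → x (suc i)) (suc k)) (pathContinuant (λ i → x (2 ℕ.+ i)) k))
    where
    regroup : ∀ x₀ x₁ z p a b → (x₀ + x₁) * (x₁ * p + z * a) - x₁ * x₁ * (p + z * b)
                                ≈ x₀ * (x₁ * p) + z * ((x₀ + x₁) * a - x₁ * x₁ * b)
    regroup = solve 6 (λ x₀ x₁ z p a b →
      (x₀ :+ x₁) :* (x₁ :* p :+ z :* a) :- x₁ :* x₁ :* (p :+ z :* b)
        := x₀ :* (x₁ :* p) :+ z :* ((x₀ :+ x₁) :* a :- x₁ :* x₁ :* b)) refl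

  pathContinuant-cycle : ∀ m (x : ℕ → Carrier) →
    (x 0 + x (2 ℕ.+ m)) * pathContinuant x (2 ℕ.+ m)
      - x 0 * x 0 * pathContinuant (λ i → x (suc i)) (suc m)
      - x (2 ℕ.+ m) * x (2 ℕ.+ m) * pathContinuant x (suc m)
    ≈ (1# + 1#) * prodℕ x (3 ℕ.+ m)
  pathContinuant-cycle m x = begin
    (a + z) * pathContinuant x (2 ℕ.+ m) - a * a * pathContinuant x′ (suc m) - z * z * pathContinuant x (suc m)
      ≈⟨ +-cong (+-cong (*-congˡ (trans (pathContinuant-peelˡ (suc m) x)
                                        (+-cong (prodℕ-snoc (suc m) x′) (*-congˡ inner))))
                        (-‿cong (*-congˡ inner)))
                (-‿cong (*-congˡ (pathContinuant-peelˡ m x))) ⟩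
    (a + z) * (p * z + a * (p + z * e)) - a * a * (p + z * e) - z * z * (p + a * e)
      ≈⟨ collapse a z p e ⟩
    (1# + 1#) * (a * (p * z))
      ≈⟨ *-congˡ (*-congˡ (sym (prodℕ-snoc (suc m) x′))) ⟩
    (1# + 1#) * prodℕ x (3 ℕ.+ m) ∎
    where
    open import Relation.Binary.Reasoning.Setoid setoid
    x′ : ℕ → Carrier
    x′ i = x (suc i)
    a z p e : Carrier
    a = x 0
    z = x (2 ℕ.+ m)
    p = prodℕ x′ (suc m)
    e = pathContinuant x′ m
    inner : pathContinuant x′ (suc m) ≈ p + z * e
    inner = pathContinuant-peelʳ m x′
    collapse : ∀ a z p e → (a + z) * (p * z + a * (p + z * e)) - a * a * (p + z * e) - z * z * (p + a * e)
                           ≈ (1# + 1#) * (a * (p * z))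
    collapse = solve 4 (λ a z p e →
      (a :+ z) :* (p :* z :+ a :* (p :+ z :* e)) :- a :* a :* (p :+ z :* e) :- z :* z :* (p :+ a :* e)
        := (con (1 , 0) :+ con (1 , 0)) :* (a :* (p :* z))) refl

toℕ-punchIn-fromℕ : ∀ n (k : Fin n) → toℕ (punchIn (fromℕ n) k) ≡ toℕ k
toℕ-punchIn-fromℕ (suc n) zero    = ≡.refl
toℕ-punchIn-fromℕ (suc n) (suc k) = ≡.cong suc (toℕ-punchIn-fromℕ n k)

module CyclicTridiagonal {c ℓ} (K : CommutativeRing c ℓ) where
  open CommutativeRing K hiding (zero)
  open RingDefs K
  open Determinant K
  open Products K using (prodℕ; prodFin-toℕ; prodℕ-neg; sgn-square)
  open IntegerCoefficientSolver K using (solve; _:+_; _:*_; :-_; _:-_; con; _:=_)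
  open import Relation.Binary.Reasoning.Setoid setoid

  CyclicBand : ℕ → (ℕ → ℕ → Carrier) → Set ℓ
  CyclicBand L C = ∀ a b → b ℕ.≤ L → 2 ℕ.+ a ℕ.≤ b → (a , b) ≢ (0 , L) → C a b ≈ 0# × C b a ≈ 0#

  CyclicBand⇒Tridiagonal : ∀ {L C k} → CyclicBand L C → k ℕ.≤ L → Tridiagonal k (shift C)
  CyclicBand⇒Tridiagonal band k≤L a b b<k a+2≤b = band (suc a) (suc b) (ℕₚ.≤-trans b<k k≤L) (s≤s a+2≤b) λ ()

  module _ (m : ℕ) (C : ℕ → ℕ → Carrier) (band : CyclicBand (2 ℕ.+ m) C) where
    private
      L : ℕ
      L = 2 ℕ.+ m
      M : Matrix (3 ℕ.+ m)
      M i j = C (toℕ i) (toℕ j)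
      σ T₁ T₂ T₃ Pᵃ Pᵇ : Carrier
      σ  = sgn (fromℕ (suc m))
      T₁ = bandContinuant (shift C) L
      T₂ = bandContinuant (shift (shift C)) (suc m)
      T₃ = bandContinuant (shift C) (suc m)
      Pᵃ = prodℕ (λ i → C (suc i) (2 ℕ.+ i)) (suc m)
      Pᵇ = prodℕ (λ i → C (2 ℕ.+ i) (suc i)) (suc m)

      off-corner : ∀ a b → b ℕ.≤ L → 3 ℕ.+ a ℕ.≤ b → C (suc a) b ≈ 0# × C b (suc a) ≈ 0#
      off-corner a b b≤L a+3≤b = band (suc a) b b≤L a+3≤b λ ()

      corner-row-zero : ∀ t → t ℕ.< m → C 0 (2 ℕ.+ t) ≈ 0# × C (2 ℕ.+ t) 0 ≈ 0#
      corner-row-zero t t<m = band 0 (2 ℕ.+ t) (s≤s (s≤s (ℕₚ.<⇒≤ t<m))) (s≤s (s≤s z≤n))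
        λ eq → ℕₚ.<⇒≢ t<m (ℕₚ.suc-injective (ℕₚ.suc-injective (≡.cong proj₂ eq)))

      column0-zero : ∀ (r : Fin m) → C (2 ℕ.+ toℕ (inject₁ r)) 0 ≈ 0#
      column0-zero r = trans (reflexive (≡.cong (λ t → C (2 ℕ.+ t) 0) (Finₚ.toℕ-inject₁ r)))
                             (proj₂ (corner-row-zero (toℕ r) (Finₚ.toℕ<n r)))

      C-last-0 : C (suc (toℕ (fromℕ (suc m)))) 0 ≈ C L 0
      C-last-0 = reflexive (≡.cong (λ t → C (suc t) 0) (Finₚ.toℕ-fromℕ (suc m)))

      minor₁-upper-zero : ∀ (r k : Fin (suc m)) → r Fin.< k → C (suc (toℕ (inject₁ r))) (2 ℕ.+ toℕ k) ≈ 0#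
      minor₁-upper-zero r k r<k = proj₁ (off-corner (toℕ (inject₁ r)) (2 ℕ.+ toℕ k)
        (s≤s (s≤s (Finₚ.toℕ≤pred[n] k))) (s≤s (s≤s (≡.subst (ℕ._< toℕ k) (≡.sym (Finₚ.toℕ-inject₁ r)) r<k))))

      minorL-lower-zero : ∀ (r k : Fin (suc m)) → k Fin.< r → C (2 ℕ.+ toℕ r) (suc (toℕ k)) ≈ 0#
      minorL-lower-zero r k k<r =
        proj₂ (off-corner (toℕ k) (2 ℕ.+ toℕ r) (s≤s (s≤s (Finₚ.toℕ≤pred[n] r))) (s≤s (s≤s k<r)))

      det-minor₁ : det L (minor M (suc zero)) ≈ C 1 0 * T₂ + σ * (C L 0 * Pᵃ)
      det-minor₁ = trans (det-column0-corners m (minor M (suc zero)) column0-zero)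
        (+-cong (*-congˡ (det-tridiagonal (suc m) (shift (shift C))
                                          (Tridiagonal-shift (CyclicBand⇒Tridiagonal band ℕₚ.≤-refl))))
                (*-congˡ (*-cong C-last-0 (begin
          det (suc m) (λ r k → C (suc (toℕ (inject₁ r))) (2 ℕ.+ toℕ k))
            ≈⟨ det-lowerTriangular (suc m) _ minor₁-upper-zero ⟩
          prodFin {suc m} (λ i → C (suc (toℕ (inject₁ i))) (2 ℕ.+ toℕ i))
            ≈⟨ prodFin-cong {suc m} (λ i → reflexive (≡.cong (λ t → C (suc t) (2 ℕ.+ toℕ i)) (Finₚ.toℕ-inject₁ i))) ⟩
          prodFin {suc m} (λ i → C (suc (toℕ i)) (2 ℕ.+ toℕ i))
            ≈⟨ prodFin-toℕ (suc m) (λ i → C (suc i) (2 ℕ.+ i)) ⟩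
          Pᵃ ∎))))

      N : Matrix L
      N r k = C (suc (toℕ r)) (toℕ k)

      det-minorL : det L (minor M (fromℕ L)) ≈ C 1 0 * Pᵇ + σ * (C L 0 * T₃)
      det-minorL = begin
        det L (minor M (fromℕ L))
          ≈⟨ det-cong L (λ r k → reflexive (≡.cong (C (suc (toℕ r))) (toℕ-punchIn-fromℕ L k))) ⟩
        det L N
          ≈⟨ det-column0-corners m N column0-zero ⟩
        C 1 0 * det (suc m) (minor N zero) + σ * (N (fromℕ (suc m)) zero * det (suc m) (λ r k → N (inject₁ r) (suc k)))
          ≈⟨ +-cong (*-congˡ (trans (det-upperTriangular (suc m) (minor N zero) minorL-lower-zero)
                                    (prodFin-toℕ (suc m) (λ i → C (2 ℕ.+ i) (suc i)))))
                    (*-congˡ (*-cong C-last-0 (trans (det-cong (suc m) N-inject₁)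
                      (det-tridiagonal (suc m) (shift C) (CyclicBand⇒Tridiagonal band (ℕₚ.n≤1+n (suc m))))))) ⟩
        C 1 0 * Pᵇ + σ * (C L 0 * T₃) ∎
        where
        N-inject₁ : ∀ r k → N (inject₁ r) (suc k) ≈ C (suc (toℕ r)) (suc (toℕ k))
        N-inject₁ r k = reflexive (≡.cong (λ t → C (suc t) (suc (toℕ k))) (Finₚ.toℕ-inject₁ r))

      cofactors≥2 : sumFin (λ j → cofactor M (suc (suc j))) ≈ (- σ) * (C 0 L * (C 1 0 * Pᵇ + σ * (C L 0 * T₃)))
      cofactors≥2 = trans (sumFin-single {h = λ j → cofactor M (suc (suc j))} (fromℕ m) vanishing)
                          (*-congˡ (*-cong (reflexive (≡.cong (C 0) (Finₚ.toℕ-fromℕ L))) det-minorL))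
        where
        vanishing : ∀ j → j ≢ fromℕ m → cofactor M (suc (suc j)) ≈ 0#
        vanishing j j≢m = cofactor-zeroˡ _ _ (proj₁ (corner-row-zero (toℕ j) (ℕₚ.≤∧≢⇒< (Finₚ.toℕ≤pred[n] j)
          λ eq → j≢m (Finₚ.toℕ-injective (≡.trans eq (≡.sym (Finₚ.toℕ-fromℕ m)))))))

      expand : ∀ d t₁ c₀₁ c₁₀ t₂ σ cₗ₀ pᵃ c₀ₗ pᵇ t₃ →
        1# * (d * t₁) + ((- 1#) * (c₀₁ * (c₁₀ * t₂ + σ * (cₗ₀ * pᵃ))) + (- σ) * (c₀ₗ * (c₁₀ * pᵇ + σ * (cₗ₀ * t₃))))
        ≈ d * t₁ - c₀₁ * c₁₀ * t₂ - (σ * σ) * (cₗ₀ * c₀ₗ * t₃) - (- c₀₁ * (σ * pᵃ) * - cₗ₀ + - c₁₀ * (σ * pᵇ) * - c₀ₗ)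
      expand = solve 11 (λ d t₁ c₀₁ c₁₀ t₂ σ cₗ₀ pᵃ c₀ₗ pᵇ t₃ →
        con (1 , 0) :* (d :* t₁) :+ ((:- con (1 , 0)) :* (c₀₁ :* (c₁₀ :* t₂ :+ σ :* (cₗ₀ :* pᵃ)))
                                    :+ (:- σ) :* (c₀ₗ :* (c₁₀ :* pᵇ :+ σ :* (cₗ₀ :* t₃))))
        := d :* t₁ :- c₀₁ :* c₁₀ :* t₂ :- (σ :* σ) :* (cₗ₀ :* c₀ₗ :* t₃)
           :- ((:- c₀₁) :* (σ :* pᵃ) :* (:- cₗ₀) :+ (:- c₁₀) :* (σ :* pᵇ) :* (:- c₀ₗ))) refl

    -- The minors at columns 1 and L have their first column supported on its first and last rows.
    det-cyclicTridiagonal :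
      det (3 ℕ.+ m) (λ i j → C (toℕ i) (toℕ j)) ≈
        C 0 0 * bandContinuant (shift C) (2 ℕ.+ m)
        - C 0 1 * C 1 0 * bandContinuant (shift (shift C)) (suc m)
        - C (2 ℕ.+ m) 0 * C 0 (2 ℕ.+ m) * bandContinuant (shift C) (suc m)
        - (prodℕ (λ i → - C i (suc i)) (2 ℕ.+ m) * - C (2 ℕ.+ m) 0
           + prodℕ (λ i → - C (suc i) i) (2 ℕ.+ m) * - C 0 (2 ℕ.+ m))
    det-cyclicTridiagonal = begin
      det (3 ℕ.+ m) M
        ≈⟨ +-cong (*-congˡ (*-congˡ (det-tridiagonal L (shift C) (CyclicBand⇒Tridiagonal band ℕₚ.≤-refl))))
                  (+-cong (*-congˡ (*-congˡ det-minor₁)) cofactors≥2) ⟩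
      1# * (C 0 0 * T₁) + ((- 1#) * (C 0 1 * (C 1 0 * T₂ + σ * (C L 0 * Pᵃ)))
                          + (- σ) * (C 0 L * (C 1 0 * Pᵇ + σ * (C L 0 * T₃))))
        ≈⟨ expand (C 0 0) T₁ (C 0 1) (C 1 0) T₂ σ (C L 0) Pᵃ (C 0 L) Pᵇ T₃ ⟩
      C 0 0 * T₁ - C 0 1 * C 1 0 * T₂ - (σ * σ) * (C L 0 * C 0 L * T₃)
        - (- C 0 1 * (σ * Pᵃ) * - C L 0 + - C 1 0 * (σ * Pᵇ) * - C 0 L)
        ≈⟨ +-cong (+-congˡ (-‿cong (trans (*-congʳ (sgn-square (fromℕ (suc m)))) (*-identityˡ _))))
                  (-‿cong (+-cong (*-congʳ (*-congˡ (sym (prodℕ-neg (suc m) (λ i → C (suc i) (2 ℕ.+ i))))))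
                                  (*-congʳ (*-congˡ (sym (prodℕ-neg (suc m) (λ i → C (2 ℕ.+ i) (suc i)))))))) ⟩
      C 0 0 * T₁ - C 0 1 * C 1 0 * T₂ - C L 0 * C 0 L * T₃
        - (prodℕ (λ i → - C i (suc i)) L * - C L 0 + prodℕ (λ i → - C (suc i) i) L * - C 0 L) ∎

cyclicSuc : ℕ → ℕ → ℕ
cyclicSuc L a = if a ℕ.≡ᵇ L then 0 else suc a

cyclicPred : ℕ → ℕ → ℕ
cyclicPred L zero    = L
cyclicPred L (suc a) = a

cyclicSuc-cases : ∀ L a → (a ≡ L × cyclicSuc L a ≡ 0) ⊎ (a ≢ L × cyclicSuc L a ≡ suc a)
cyclicSuc-cases L a with a ℕ.≡ᵇ L in eq
... | true  = inj₁ (ℕₚ.≡ᵇ⇒≡ a L (≡.subst T (≡.sym eq) _) , ≡.refl)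
... | false = inj₂ ((λ a≡L → ≡.subst T eq (ℕₚ.≡⇒≡ᵇ a L a≡L)) , ≡.refl)

cyclicSuc-< : ∀ {L a} → a ℕ.< L → cyclicSuc L a ≡ suc a
cyclicSuc-< {L} {a} a<L with cyclicSuc-cases L a
... | inj₁ (a≡L , _) = ⊥-elim (ℕₚ.<⇒≢ a<L a≡L)
... | inj₂ (_ , eq)  = eq

cyclicSuc-last : ∀ L → cyclicSuc L L ≡ 0
cyclicSuc-last L with cyclicSuc-cases L L
... | inj₁ (_ , eq)  = eq
... | inj₂ (L≢L , _) = ⊥-elim (L≢L ≡.refl)

cyclicSuc≢id : ∀ L a → cyclicSuc (suc L) a ≢ a
cyclicSuc≢id L a with cyclicSuc-cases (suc L) a
... | inj₁ (a≡L , eq) = λ eq′ → ℕₚ.0≢1+n (≡.trans (≡.sym eq) (≡.trans eq′ a≡L))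
... | inj₂ (_ , eq)   = λ eq′ → ℕₚ.1+n≢n (≡.trans (≡.sym eq) eq′)

cyclicPred-cyclicSuc : ∀ L a → cyclicPred L (cyclicSuc L a) ≡ a
cyclicPred-cyclicSuc L a with cyclicSuc-cases L a
... | inj₁ (a≡L , eq) = ≡.trans (≡.cong (cyclicPred L) eq) (≡.sym a≡L)
... | inj₂ (_ , eq)   = ≡.cong (cyclicPred L) eq

cyclicSuc-cyclicPred : ∀ {L a} → a ℕ.≤ L → cyclicSuc L (cyclicPred L a) ≡ a
cyclicSuc-cyclicPred {L} {zero}  _   = cyclicSuc-last L
cyclicSuc-cyclicPred {L} {suc a} a<L = cyclicSuc-< a<L

toℕ-next : ∀ k (i : Fin (suc k)) → toℕ (next i) ≡ cyclicSuc k (toℕ i)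
toℕ-next zero    zero    = ≡.refl
toℕ-next (suc k) zero    = ≡.refl
toℕ-next (suc k) (suc i) =
  ≡.trans (toℕ-next-suc i) (≡.trans (≡.cong skipZero (toℕ-next k i)) (skipZero-cyclicSuc (toℕ i)))
  where
  skipZero : ℕ → ℕ
  skipZero zero    = zero
  skipZero (suc a) = suc (suc a)
  toℕ-next-suc : ∀ (i : Fin (suc k)) → toℕ (next (suc i)) ≡ skipZero (toℕ (next i))
  toℕ-next-suc i with next i
  ... | zero  = ≡.refl
  ... | suc j = ≡.refl
  skipZero-cyclicSuc : ∀ a → skipZero (cyclicSuc k a) ≡ cyclicSuc (suc k) (suc a)
  skipZero-cyclicSuc a with a ℕ.≡ᵇ k
  ... | true  = ≡.refl
  ... | false = ≡.refl

prev : ∀ {k} → Fin (suc k) → Fin (suc k)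
prev {k} zero = fromℕ k
prev (suc i)  = inject₁ i

toℕ-prev : ∀ k (i : Fin (suc k)) → toℕ (prev i) ≡ cyclicPred k (toℕ i)
toℕ-prev k       zero    = Finₚ.toℕ-fromℕ k
toℕ-prev (suc k) (suc i) = Finₚ.toℕ-inject₁ i

next-prev : ∀ {k} (i : Fin (suc k)) → next (prev i) ≡ i
next-prev {k} i = Finₚ.toℕ-injective (begin
  toℕ (next (prev i))                 ≡⟨ toℕ-next k (prev i) ⟩
  cyclicSuc k (toℕ (prev i))          ≡⟨ ≡.cong (cyclicSuc k) (toℕ-prev k i) ⟩
  cyclicSuc k (cyclicPred k (toℕ i))  ≡⟨ cyclicSuc-cyclicPred (Finₚ.toℕ≤pred[n] i) ⟩
  toℕ i                               ∎)
  where open ≡.≡-Reasoning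

prev-next : ∀ {k} (i : Fin (suc k)) → prev (next i) ≡ i
prev-next {k} i = Finₚ.toℕ-injective (begin
  toℕ (prev (next i))                 ≡⟨ toℕ-prev k (next i) ⟩
  cyclicPred k (toℕ (next i))         ≡⟨ ≡.cong (cyclicPred k) (toℕ-next k i) ⟩
  cyclicPred k (cyclicSuc k (toℕ i))  ≡⟨ cyclicPred-cyclicSuc k (toℕ i) ⟩
  toℕ i                               ∎)
  where open ≡.≡-Reasoning

next≢id : ∀ {k} (i : Fin (suc (suc k))) → next i ≢ i
next≢id {k} i eq = cyclicSuc≢id k (toℕ i) (≡.trans (≡.sym (toℕ-next (suc k) i)) (≡.cong toℕ eq))

extend : ∀ {a} {A : Set a} {n} → A → (Fin n → A) → ℕ → A
extend {n = zero}  x h _       = x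
extend {n = suc n} x h zero    = h zero
extend {n = suc n} x h (suc a) = extend x (λ i → h (suc i)) a

extend-toℕ : ∀ {a} {A : Set a} {n} (x : A) (h : Fin n → A) i → extend x h (toℕ i) ≡ h i
extend-toℕ x h zero    = ≡.refl
extend-toℕ x h (suc i) = extend-toℕ x (λ i → h (suc i)) i

isYes-⇔ : ∀ {A B : Set} (a? : Dec A) (b? : Dec B) → (A → B) → (B → A) → ⌊ a? ⌋ ≡ ⌊ b? ⌋
isYes-⇔ (yes _) (yes _) _   _   = ≡.refl
isYes-⇔ (no _)  (no _)  _   _   = ≡.refl
isYes-⇔ (yes a) (no ¬b) a→b _   = ⊥-elim (¬b (a→b a))
isYes-⇔ (no ¬a) (yes b) _   b→a = ⊥-elim (¬a (b→a b))

if-yes : ∀ {a} {X : Set a} {A : Set} (a? : Dec A) {x y : X} → A → (if ⌊ a? ⌋ then x else y) ≡ x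
if-yes (yes _) _ = ≡.refl
if-yes (no ¬a) a = ⊥-elim (¬a a)

if-no : ∀ {a} {X : Set a} {A : Set} (a? : Dec A) {x y : X} → ¬ A → (if ⌊ a? ⌋ then x else y) ≡ y
if-no (yes a) ¬a = ⊥-elim (¬a a)
if-no (no _)  _  = ≡.refl

module CycleEntry {c ℓ} (K : CommutativeRing c ℓ) where
  open CommutativeRing K hiding (zero)
  open import Algebra.Properties.Ring ring using (-0#≈0#)

  if-cong : ∀ {b b′ : Bool} {x x′ y y′} → b ≡ b′ → x ≈ x′ → y ≈ y′ → (if b then x else y) ≈ (if b′ then x′ else y′)
  if-cong {false} ≡.refl _   y≈y′ = y≈y′
  if-cong {true}  ≡.refl x≈x′ _  = x≈x′

  if-∨ : ∀ {A B : Set} (a? : Dec A) (b? : Dec B) {x} → ¬ (A × B) →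
         (if ⌊ a? ⌋ ∨ ⌊ b? ⌋ then x else 0#) ≈ (if ⌊ a? ⌋ then x else 0#) + (if ⌊ b? ⌋ then x else 0#)
  if-∨ (yes a) (yes b) ¬ab = ⊥-elim (¬ab (a , b))
  if-∨ (yes _) (no _)  _   = sym (+-identityʳ _)
  if-∨ (no _)  (yes _) _   = sym (+-identityˡ _)
  if-∨ (no _)  (no _)  _   = sym (+-identityʳ 0#)

  -- SkewGainCycle.Lg is cycleEntry Fin._≟_ next degG (ι ∘ w) (ι ∘ f ∘ w) by definition.
  cycleEntry : {I : Set} → DecidableEquality I → (I → I) → (d W V : I → Carrier) → I → I → Carrier
  cycleEntry _≟_ nxt d W V i j =
    (if ⌊ i ≟ j ⌋ then d i else 0#) - (if ⌊ j ≟ nxt i ⌋ then W i else if ⌊ i ≟ nxt j ⌋ then V j else 0#)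

  module _ {I : Set} (_≟_ : DecidableEquality I) (nxt : I → I) (d W V : I → Carrier) where
    private
      E : I → I → Carrier
      E = cycleEntry _≟_ nxt d W V

    cycleEntry-diag : ∀ {i} → i ≢ nxt i → E i i ≈ d i
    cycleEntry-diag {i} i≢nxt = begin
      E i i    ≈⟨ +-cong (reflexive (if-yes (i ≟ i) ≡.refl))
                         (-‿cong (reflexive (≡.trans (if-no (i ≟ nxt i) i≢nxt) (if-no (i ≟ nxt i) i≢nxt)))) ⟩
      d i - 0# ≈⟨ +-congˡ -0#≈0# ⟩
      d i + 0# ≈⟨ +-identityʳ (d i) ⟩
      d i      ∎
      where open import Relation.Binary.Reasoning.Setoid setoid

    cycleEntry-next : ∀ {i j} → i ≢ j → j ≡ nxt i → E i j ≈ - W i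
    cycleEntry-next {i} {j} i≢j j≡nxt =
      trans (+-congʳ (reflexive (if-no (i ≟ j) i≢j)))
            (trans (+-congˡ (-‿cong (reflexive (if-yes (j ≟ nxt i) j≡nxt)))) (+-identityˡ _))

    cycleEntry-prev : ∀ {i j} → i ≢ j → j ≢ nxt i → i ≡ nxt j → E i j ≈ - V j
    cycleEntry-prev {i} {j} i≢j j≢nxt i≡nxt =
      trans (+-congʳ (reflexive (if-no (i ≟ j) i≢j)))
            (trans (+-congˡ (-‿cong (reflexive (≡.trans (if-no (j ≟ nxt i) j≢nxt) (if-yes (i ≟ nxt j) i≡nxt)))))
                   (+-identityˡ _))

    cycleEntry-far : ∀ {i j} → i ≢ j → j ≢ nxt i → i ≢ nxt j → E i j ≈ 0#
    cycleEntry-far {i} {j} i≢j j≢nxt i≢nxt =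
      trans (+-cong (reflexive (if-no (i ≟ j) i≢j))
                    (-‿cong (reflexive (≡.trans (if-no (j ≟ nxt i) j≢nxt) (if-no (i ≟ nxt j) i≢nxt)))))
            (-‿inverseʳ 0#)

module AutomorphismProducts {c ℓ} (F : CommutativeRing c ℓ) (F-field : RingDefs.IsField F)
    {f : CommutativeRing.Carrier F → CommutativeRing.Carrier F} (f-aut : IsInvolutiveAutF× F f) where
  open CommutativeRing F hiding (zero)
  open RingDefs F
  open IsInvolutiveAutF× f-aut
  open import Relation.Binary.Reasoning.Setoid setoid

  *-nonzero : ∀ {x y} → ¬ x ≈ 0# → ¬ y ≈ 0# → ¬ x * y ≈ 0#
  *-nonzero {x} {y} x≉0 y≉0 xy≈0 with proj₂ F-field x x≉0
  ... | x⁻¹ , xx⁻¹≈1 = y≉0 (begin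
    y              ≈⟨ sym (*-identityˡ y) ⟩
    1# * y         ≈⟨ *-congʳ (trans (sym xx⁻¹≈1) (*-comm x x⁻¹)) ⟩
    x⁻¹ * x * y    ≈⟨ *-assoc x⁻¹ x y ⟩
    x⁻¹ * (x * y)  ≈⟨ *-congˡ xy≈0 ⟩
    x⁻¹ * 0#       ≈⟨ zeroʳ x⁻¹ ⟩
    0#             ∎)

  prodFin-nonzero : ∀ n (h : Fin n → Carrier) → (∀ j → ¬ h j ≈ 0#) → ¬ prodFin h ≈ 0#
  prodFin-nonzero zero    h h≉0 = proj₁ F-field
  prodFin-nonzero (suc n) h h≉0 = *-nonzero (h≉0 zero) (prodFin-nonzero n (λ j → h (suc j)) (λ j → h≉0 (suc j)))

  f-prodFin : ∀ n (h : Fin (suc n) → Carrier) → (∀ j → ¬ h j ≈ 0#) → f (prodFin h) ≈ prodFin (λ j → f (h j))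
  f-prodFin zero    h h≉0 =
    trans (f-cong _ _ (*-nonzero (h≉0 zero) (proj₁ F-field)) (*-identityʳ _)) (sym (*-identityʳ _))
  f-prodFin (suc n) h h≉0 =
    trans (f-hom _ _ (h≉0 zero) (prodFin-nonzero (suc n) (λ j → h (suc j)) (λ j → h≉0 (suc j))))
          (*-congˡ (f-prodFin n (λ j → h (suc j)) (λ j → h≉0 (suc j))))

module HomomorphismProducts {c ℓ c′ ℓ′} (F : CommutativeRing c ℓ) (K : CommutativeRing c′ ℓ′)
    {ι : CommutativeRing.Carrier F → CommutativeRing.Carrier K}
    (ι-hom : IsRingHomomorphism (CommutativeRing.rawRing F) (CommutativeRing.rawRing K) ι) where
  open CommutativeRing K
  open IsRingHomomorphism ι-hom

  ι-prodFin : ∀ n (h : Fin n → CommutativeRing.Carrier F) →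
              ι (RingDefs.prodFin F h) ≈ RingDefs.prodFin K (λ j → ι (h j))
  ι-prodFin zero    h = 1#-homo
  ι-prodFin (suc n) h = trans (*-homo _ _) (*-congˡ (ι-prodFin n (λ j → h (suc j))))

module SkewGainCycleDeterminant {c ℓ c′ ℓ′} (F : CommutativeRing c ℓ) (K : CommutativeRing c′ ℓ′)
    (ι : CommutativeRing.Carrier F → CommutativeRing.Carrier K)
    (f : CommutativeRing.Carrier F → CommutativeRing.Carrier F)
    (m : ℕ) (w : Fin (3 ℕ.+ m) → CommutativeRing.Carrier F) (s : Fin (3 ℕ.+ m) → CommutativeRing.Carrier K)
    (ι-hom : IsRingHomomorphism (CommutativeRing.rawRing F) (CommutativeRing.rawRing K) ι)
    (s-square : ∀ j → CommutativeRing._≈_ K (CommutativeRing._*_ K (s j) (s j))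
                                           (ι (CommutativeRing._*_ F (w j) (f (w j))))) where
  open CommutativeRing K hiding (zero)
  open RingDefs K
  open SkewGainCycle F K ι f m w s using (Lg; degG; φC)
  private module F = CommutativeRing F
  open Determinant K
  open Products K
  open PathContinuant K
  open CyclicTridiagonal K
  open CycleEntry K
  open IntegerCoefficientSolver K using (solve; _:*_; :-_; _:=_)
  open import Algebra.Properties.Ring ring using (-‿involutive)
  open import Relation.Binary.Reasoning.Setoid setoid

  L : ℕ
  L = 2 ℕ.+ m

  S W V : ℕ → Carrier
  S = extend 0# s
  W = extend 0# (λ i → ι (w i))
  V = extend 0# (λ i → ι (f (w i)))

  d : ℕ → Carrier
  d a = S a + S (cyclicPred L a)

  C : ℕ → ℕ → Carrier
  C = cycleEntry ℕ._≟_ (cyclicSuc L) d W V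

  degG≈ : ∀ i → degG i ≈ s i + s (prev i)
  degG≈ i = begin
    degG i
      ≈⟨ sumFin-cong {h′ = λ j → here j + there j} (λ j → if-∨ (i Fin.≟ j) (i Fin.≟ next j) {s j}
           λ (i≡j , i≡next) → next≢id j (≡.trans (≡.sym i≡next) i≡j)) ⟩
    sumFin (λ j → here j + there j)
      ≈⟨ sumFin-+ here there ⟩
    sumFin here + sumFin there
      ≈⟨ +-cong (trans (sumFin-single {h = here} i (λ j j≢i → reflexive (if-no (i Fin.≟ j) (j≢i ∘ ≡.sym))))
                       (reflexive (if-yes (i Fin.≟ i) ≡.refl)))
                (trans (sumFin-single {h = there} (prev i) (λ j j≢prev → reflexive (if-no (i Fin.≟ next j)
                          (λ i≡next → j≢prev (≡.trans (≡.sym (prev-next j)) (≡.cong prev (≡.sym i≡next)))))))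
                       (reflexive (if-yes (i Fin.≟ next (prev i)) (≡.sym (next-prev i))))) ⟩
    s i + s (prev i) ∎
    where
    here there : Fin (3 ℕ.+ m) → Carrier
    here  j = if ⌊ i Fin.≟ j ⌋ then s j else 0#
    there j = if ⌊ i Fin.≟ next j ⌋ then s j else 0#

  Lg≈C : ∀ i j → Lg i j ≈ C (toℕ i) (toℕ j)
  Lg≈C i j =
    +-cong (if-cong (isYes-⇔ (i Fin.≟ j) (toℕ i ℕ.≟ toℕ j) (≡.cong toℕ) Finₚ.toℕ-injective) degG≈d refl)
           (-‿cong (if-cong (toℕ-≟-next j i) (extend≈ _ i)
                   (if-cong (toℕ-≟-next i j) (extend≈ _ j) refl)))
    where
    extend≈ : (h : Fin (3 ℕ.+ m) → Carrier) (k : Fin (3 ℕ.+ m)) → h k ≈ extend 0# h (toℕ k)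
    extend≈ h k = reflexive (≡.sym (extend-toℕ 0# h k))
    degG≈d : degG i ≈ d (toℕ i)
    degG≈d = trans (degG≈ i) (+-cong (extend≈ s i)
                                      (trans (extend≈ s (prev i)) (reflexive (≡.cong S (toℕ-prev L i)))))
    toℕ-≟-next : ∀ a b → ⌊ a Fin.≟ next b ⌋ ≡ ⌊ toℕ a ℕ.≟ cyclicSuc L (toℕ b) ⌋
    toℕ-≟-next a b = isYes-⇔ (a Fin.≟ next b) (toℕ a ℕ.≟ cyclicSuc L (toℕ b))
      (λ eq → ≡.trans (≡.cong toℕ eq) (toℕ-next L b))
      (λ eq → Finₚ.toℕ-injective (≡.trans eq (≡.sym (toℕ-next L b))))

  C-band : CyclicBand L C
  C-band a b b≤L a+2≤b ab≢0L =
    cycleEntry-far ℕ._≟_ (cyclicSuc L) d W V a≢b b≢suc a≢suc ,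
    cycleEntry-far ℕ._≟_ (cyclicSuc L) d W V (a≢b ∘ ≡.sym) a≢suc b≢suc
    where
    a<b : a ℕ.< b
    a<b = ℕₚ.<-trans (ℕₚ.n<1+n a) a+2≤b
    a≢b : a ≢ b
    a≢b = ℕₚ.<⇒≢ a<b
    b≢suc : b ≢ cyclicSuc L a
    b≢suc b≡suc = ℕₚ.<⇒≢ a+2≤b (≡.trans (≡.sym (cyclicSuc-< (ℕₚ.<-≤-trans a<b b≤L))) (≡.sym b≡suc))
    a≢suc : a ≢ cyclicSuc L b
    a≢suc a≡suc with cyclicSuc-cases L b
    ... | inj₁ (b≡L , suc≡0) = ab≢0L (≡.cong₂ _,_ (≡.trans a≡suc suc≡0) b≡L)
    ... | inj₂ (_ , suc≡)    = ℕₚ.<⇒≢ (ℕₚ.<-trans a<b (ℕₚ.n<1+n b)) (≡.trans a≡suc suc≡)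

  C-diag : ∀ a → C a a ≈ d a
  C-diag a = cycleEntry-diag ℕ._≟_ (cyclicSuc L) d W V (cyclicSuc≢id (suc m) a ∘ ≡.sym)

  C-next : ∀ {a} → a ℕ.< L → C a (suc a) ≈ - W a
  C-next a<L = cycleEntry-next ℕ._≟_ (cyclicSuc L) d W V (ℕₚ.1+n≢n ∘ ≡.sym) (≡.sym (cyclicSuc-< a<L))

  C-prev : ∀ {a} → a ℕ.< L → C (suc a) a ≈ - V a
  C-prev {a} a<L = cycleEntry-prev ℕ._≟_ (cyclicSuc L) d W V ℕₚ.1+n≢n a≢suc (≡.sym (cyclicSuc-< a<L))
    where
    a≢suc : a ≢ cyclicSuc L (suc a)
    a≢suc a≡suc with cyclicSuc-cases L (suc a)
    ... | inj₁ (a+1≡L , suc≡0) = ℕₚ.0≢1+n (ℕₚ.suc-injective (≡.trans (≡.cong suc (≡.sym (≡.trans a≡suc suc≡0))) a+1≡L))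
    ... | inj₂ (_ , suc≡)      = ℕₚ.<⇒≢ (ℕₚ.<-trans (ℕₚ.n<1+n a) (ℕₚ.n<1+n (suc a))) (≡.trans a≡suc suc≡)

  C-last-first : C L 0 ≈ - W L
  C-last-first = cycleEntry-next ℕ._≟_ (cyclicSuc L) d W V (λ ()) (≡.sym (cyclicSuc-last L))

  C-first-last : C 0 L ≈ - V L
  C-first-last = cycleEntry-prev ℕ._≟_ (cyclicSuc L) d W V (λ ()) L≢suc (≡.sym (cyclicSuc-last L))
    where
    L≢suc : L ≢ cyclicSuc L 0
    L≢suc L≡suc = ℕₚ.0≢1+n (≡.sym (ℕₚ.suc-injective (≡.trans L≡suc (cyclicSuc-< {L} {0} (s≤s z≤n)))))

  W*V≈S*S : ∀ {a} → a ℕ.< 3 ℕ.+ m → W a * V a ≈ S a * S a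
  W*V≈S*S a<n = ≡.subst (λ a → W a * V a ≈ S a * S a) (Finₚ.toℕ-fromℕ< a<n) (at (fromℕ< a<n))
    where
    open IsRingHomomorphism ι-hom using (*-homo)
    at : ∀ i → W (toℕ i) * V (toℕ i) ≈ S (toℕ i) * S (toℕ i)
    at i = begin
      W (toℕ i) * V (toℕ i)   ≈⟨ reflexive (≡.cong₂ _*_ (extend-toℕ 0# _ i) (extend-toℕ 0# _ i)) ⟩
      ι (w i) * ι (f (w i))   ≈⟨ sym (*-homo (w i) (f (w i))) ⟩
      ι (w i F.* f (w i))     ≈⟨ sym (s-square i) ⟩
      s i * s i               ≈⟨ sym (reflexive (≡.cong₂ _*_ (extend-toℕ 0# s i) (extend-toℕ 0# s i))) ⟩
      S (toℕ i) * S (toℕ i)   ∎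

  neg-*-neg : ∀ x y → - x * - y ≈ x * y
  neg-*-neg = solve 2 (λ x y → (:- x) :* (:- y) := x :* y) refl

  edge-product : ∀ {a} → a ℕ.< L → C a (suc a) * C (suc a) a ≈ S a * S a
  edge-product a<L = trans (*-cong (C-next a<L) (C-prev a<L)) (trans (neg-*-neg _ _) (W*V≈S*S (ℕₚ.m<n⇒m<1+n a<L)))

  corner-product : C L 0 * C 0 L ≈ S L * S L
  corner-product = trans (*-cong C-last-first C-first-last) (trans (neg-*-neg _ _) (W*V≈S*S ℕₚ.≤-refl))

  bandContinuant₁ : ∀ k → k ℕ.≤ L → bandContinuant (shift C) k ≈ pathContinuant S k
  bandContinuant₁ k k≤L = continuant-cong k (λ i _ → trans (C-diag (suc i)) (+-comm _ _))
                                            (λ i i+1<k → edge-product (ℕₚ.<-≤-trans i+1<k k≤L))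

  bandContinuant₂ : ∀ k → suc k ℕ.≤ L →
                    bandContinuant (shift (shift C)) k ≈ pathContinuant (λ i → S (suc i)) k
  bandContinuant₂ k k<L = continuant-cong k (λ i _ → trans (C-diag (2 ℕ.+ i)) (+-comm _ _))
                                            (λ i i+1<k → edge-product (ℕₚ.<-≤-trans (s≤s i+1<k) k<L))

  prodFin≈prodℕ : (h : Fin (3 ℕ.+ m) → Carrier) → prodFin h ≈ prodℕ (extend 0# h) (3 ℕ.+ m)
  prodFin≈prodℕ h =
    trans (prodFin-cong (λ i → reflexive (≡.sym (extend-toℕ 0# h i)))) (prodFin-toℕ (3 ℕ.+ m) (extend 0# h))

  ι-φC+fφC : RingDefs.IsField F → IsInvolutiveAutF× F f → (∀ j → ¬ w j F.≈ F.0#) →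
             ι (φC F.+ f φC) ≈ prodℕ W (3 ℕ.+ m) + prodℕ V (3 ℕ.+ m)
  ι-φC+fφC F-field f-aut w≉0 = begin
    ι (φC F.+ f φC)                                   ≈⟨ +-homo φC (f φC) ⟩
    ι φC + ι (f φC)                                   ≈⟨ +-congˡ (⟦⟧-cong (f-prodFin (2 ℕ.+ m) w w≉0)) ⟩
    ι (RingDefs.prodFin F w) + ι (RingDefs.prodFin F (λ j → f (w j)))
      ≈⟨ +-cong (trans (ι-prodFin _ w) (prodFin≈prodℕ (λ j → ι (w j))))
                (trans (ι-prodFin _ (λ j → f (w j))) (prodFin≈prodℕ (λ j → ι (f (w j))))) ⟩
    prodℕ W (3 ℕ.+ m) + prodℕ V (3 ℕ.+ m)             ∎
    where
    open IsRingHomomorphism ι-hom using (+-homo; ⟦⟧-cong)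
    open AutomorphismProducts F F-field f-aut using (f-prodFin)
    open HomomorphismProducts F K ι-hom using (ι-prodFin)

  det-Lg : det (3 ℕ.+ m) Lg ≈ (1# + 1#) * prodℕ S (3 ℕ.+ m) - (prodℕ W (3 ℕ.+ m) + prodℕ V (3 ℕ.+ m))
  det-Lg = begin
    det (3 ℕ.+ m) Lg
      ≈⟨ det-cong (3 ℕ.+ m) Lg≈C ⟩
    det (3 ℕ.+ m) (λ i j → C (toℕ i) (toℕ j))
      ≈⟨ det-cyclicTridiagonal m C C-band ⟩
    C 0 0 * bandContinuant (shift C) L
      - C 0 1 * C 1 0 * bandContinuant (shift (shift C)) (suc m)
      - C L 0 * C 0 L * bandContinuant (shift C) (suc m)
      - (prodℕ (λ i → - C i (suc i)) L * - C L 0 + prodℕ (λ i → - C (suc i) i) L * - C 0 L)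
      ≈⟨ +-cong (+-cong (+-cong (*-cong (C-diag 0) (bandContinuant₁ L ℕₚ.≤-refl))
                                (-‿cong (*-cong (edge-product (s≤s z≤n)) (bandContinuant₂ (suc m) ℕₚ.≤-refl))))
                        (-‿cong (*-cong corner-product (bandContinuant₁ (suc m) (ℕₚ.n≤1+n (suc m))))))
                (-‿cong (+-cong cycle-W cycle-V)) ⟩
    (S 0 + S L) * pathContinuant S L - S 0 * S 0 * pathContinuant (λ i → S (suc i)) (suc m)
      - S L * S L * pathContinuant S (suc m) - (prodℕ W (3 ℕ.+ m) + prodℕ V (3 ℕ.+ m))
      ≈⟨ +-congʳ (pathContinuant-cycle m S) ⟩
    (1# + 1#) * prodℕ S (3 ℕ.+ m) - (prodℕ W (3 ℕ.+ m) + prodℕ V (3 ℕ.+ m)) ∎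
    where
    cycle-W : prodℕ (λ i → - C i (suc i)) L * - C L 0 ≈ prodℕ W (3 ℕ.+ m)
    cycle-W = trans (*-cong (prodℕ-cong L (λ i i<L → trans (-‿cong (C-next i<L)) (-‿involutive _)))
                            (trans (-‿cong C-last-first) (-‿involutive _)))
                    (sym (prodℕ-snoc L W))
    cycle-V : prodℕ (λ i → - C (suc i) i) L * - C 0 L ≈ prodℕ V (3 ℕ.+ m)
    cycle-V = trans (*-cong (prodℕ-cong L (λ i i<L → trans (-‿cong (C-prev i<L)) (-‿involutive _)))
                            (trans (-‿cong C-first-last) (-‿involutive _)))
                    (sym (prodℕ-snoc L V))

mainTheorem11 : {c ℓ c' ℓ' : Level}
    (F : CommutativeRing c ℓ) → RingDefs.IsField F → RingDefs.CharZero F →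
    (K : CommutativeRing c' ℓ')
    (ι : CommutativeRing.Carrier F → CommutativeRing.Carrier K) →
    IsAlgebraicClosure F K ι →
    (f : CommutativeRing.Carrier F → CommutativeRing.Carrier F) →
    IsInvolutiveAutF× F f →
    (m : ℕ)
    (w : Fin (suc (suc (suc m))) → CommutativeRing.Carrier F) →
    (∀ j → ¬ (CommutativeRing._≈_ F (w j) (CommutativeRing.0# F))) →
    (s : Fin (suc (suc (suc m))) → CommutativeRing.Carrier K) →
    (∀ j → CommutativeRing._≈_ K (CommutativeRing._*_ K (s j) (s j))
             (ι (CommutativeRing._*_ F (w j) (f (w j))))) →
    CommutativeRing._≈_ K
      (RingDefs.det K (suc (suc (suc m))) (SkewGainCycle.Lg F K ι f m w s))
      (CommutativeRing._-_ K
        (CommutativeRing._*_ K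
          (CommutativeRing._+_ K (CommutativeRing.1# K) (CommutativeRing.1# K))
          (RingDefs.prodFin K s))
        (ι (CommutativeRing._+_ F (SkewGainCycle.φC F K ι f m w s)
                                   (f (SkewGainCycle.φC F K ι f m w s)))))
mainTheorem11 F F-field _ K ι closure f f-aut m w w≉0 s s-square = begin
  det (3 ℕ.+ m) Lg
    ≈⟨ det-Lg ⟩
  (1# + 1#) * prodℕ S (3 ℕ.+ m) - (prodℕ W (3 ℕ.+ m) + prodℕ V (3 ℕ.+ m))
    ≈⟨ +-cong (*-congˡ (sym (prodFin≈prodℕ s))) (-‿cong (sym (ι-φC+fφC F-field f-aut w≉0))) ⟩
  (1# + 1#) * prodFin s - ι (φC F.+ f φC) ∎
  where
  module F = CommutativeRing F
  open CommutativeRing K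
  open RingDefs K
  open IsAlgebraicClosure closure using (ι-hom)
  open SkewGainCycle F K ι f m w s using (Lg; φC)
  open SkewGainCycleDeterminant F K ι f m w s ι-hom s-square
  open Products K using (prodℕ)
  open import Relation.Binary.Reasoning.Setoid setoid
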